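{- For any fixed integers $n\ge 0$ and $l\ge 0$, the sequence $$\binom{n}{l}\binom{n}{0},\ \binom{n}{l-1}\binom{n}{1},\ \ldots,\ \binom{n}{0}\binom{n}{l},$$ i.e. the sequence $\left(\binom{n}{l-k}\binom{n}{k}\right)_{k=0}^{l}$, is unimodal.
   Context: Binomial coefficients $\binom{n}{m}$ are interpreted as $0$ when $m<0$ or $m>n$. A sequence of real numbers $(a_k)_{k\ge 0}$ is unimodal if there is an index $m$ such that $a_0\le a_1\le\cdots\le a_m\ge a_{m+1}\ge\cdots$. -}

module Defs where

open import Data.Nat using (ℕ; _≤_; _<_; _∸_; _*_)
open import Data.Nat.Combinatorics using (_C_)
open import Data.Product using (∃-syntax; _×_)

-- A finite sequence a 0, a 1, ..., a len (values of a outside [0, len] are ignored)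
-- is unimodal if there is an index m ≤ len with
-- a 0 ≤ a 1 ≤ ... ≤ a m ≥ a (m+1) ≥ ... ≥ a len.
UnimodalUpTo : ℕ → (ℕ → ℕ) → Set
UnimodalUpTo len a =
  ∃[ m ] (m ≤ len
         × (∀ i j → i ≤ j → j ≤ m → a i ≤ a j)
         × (∀ i j → m ≤ i → i ≤ j → j ≤ len → a j ≤ a i))

-- The sequence k ↦ C(n, l-k) * C(n, k), for k = 0, ..., l.
-- (n C k from the stdlib is 0 when k > n; for k ≤ l, l ∸ k is the true l - k.)
prodBinom : ℕ → ℕ → ℕ → ℕ
prodBinom n l k = (n C (l ∸ k)) * (n C k)

-- Write a k := C(n, l − k) C(n, k).  The ratio C(n, k+1) / C(n, k) = (n − k) / (k + 1) decreases
-- in k, so C(n, j+1) C(n, k) ≤ C(n, j) C(n, k+1) whenever k ≤ j.  Taking j = l − k − 1 gives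
-- a k ≤ a (k+1) as long as 2k + 1 ≤ l, and the same inequality with the roles of k and j swapped
-- gives a (k+1) ≤ a k once l ≤ 2k + 1; hence the sequence peaks at ⌊ l / 2 ⌋.
module Submission where

open import Defs
open import Data.Nat.Base
open import Data.Nat.Properties
open import Data.Nat.Combinatorics using (_C_; nC1≡n; nCk+nC[k+1]≡[n+1]C[k+1])
open import Data.Product using (_,_)
open import Function.Base using (flip)
open import Relation.Binary.Core using (Rel)
open import Relation.Binary.Definitions using (Reflexive; Transitive)
open import Relation.Binary.PropositionalEquality
open import Algebra.Properties.CommutativeSemigroup *-commutativeSemigroup using (interchange)
open import Data.Nat.Solver using (module +-*-Solver)
open +-*-Solver using (solve; _:=_; con; _:+_; _:*_)

[1+n]C[1+k]*[1+k]≡[1+n]*nCk : ∀ n k → (suc n C suc k) * suc k ≡ suc n * (n C k)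
[1+n]C[1+k]*[1+k]≡[1+n]*nCk n       zero    =
  trans (*-identityʳ _) (trans (nC1≡n (suc n)) (sym (*-identityʳ _)))
[1+n]C[1+k]*[1+k]≡[1+n]*nCk zero    (suc k) = refl
[1+n]C[1+k]*[1+k]≡[1+n]*nCk (suc n) (suc k) = begin
    (suc (suc n) C suc (suc k)) * suc (suc k)
  ≡⟨ cong (_* suc (suc k)) (sym (nCk+nC[k+1]≡[n+1]C[k+1] (suc n) (suc k))) ⟩
    (A + B) * suc (suc k)
  ≡⟨ solve 3 (λ a b k → (a :+ b) :* (con 2 :+ k) := (a :* (con 1 :+ k) :+ a) :+ b :* (con 2 :+ k))
             refl A B k ⟩
    (A * suc k + A) + B * suc (suc k)
  ≡⟨ cong₂ (λ x y → (x + A) + y) ([1+n]C[1+k]*[1+k]≡[1+n]*nCk n k)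
                                 ([1+n]C[1+k]*[1+k]≡[1+n]*nCk n (suc k)) ⟩
    (suc n * (n C k) + A) + suc n * (n C suc k)
  ≡⟨ solve 4 (λ m a x y → (m :* x :+ a) :+ m :* y := m :* (x :+ y) :+ a)
             refl (suc n) A (n C k) (n C suc k) ⟩
    suc n * (n C k + n C suc k) + A
  ≡⟨ cong (λ z → suc n * z + A) (nCk+nC[k+1]≡[n+1]C[k+1] n k) ⟩
    suc n * A + A
  ≡⟨ +-comm (suc n * A) A ⟩
    suc (suc n) * A
  ∎
  where
  open ≡-Reasoning
  A = suc n C suc k
  B = suc n C suc (suc k)

nC[1+k]*[1+k]+nCk*k≡n*nCk : ∀ n k → (n C suc k) * suc k + (n C k) * k ≡ n * (n C k)
nC[1+k]*[1+k]+nCk*k≡n*nCk zero    zero    = refl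
nC[1+k]*[1+k]+nCk*k≡n*nCk zero    (suc k) = refl
nC[1+k]*[1+k]+nCk*k≡n*nCk (suc n) zero    = trans (+-identityʳ _) ([1+n]C[1+k]*[1+k]≡[1+n]*nCk n 0)
nC[1+k]*[1+k]+nCk*k≡n*nCk (suc n) (suc k) = begin
    (suc n C suc (suc k)) * suc (suc k) + (suc n C suc k) * suc k
  ≡⟨ cong₂ _+_ ([1+n]C[1+k]*[1+k]≡[1+n]*nCk n (suc k)) ([1+n]C[1+k]*[1+k]≡[1+n]*nCk n k) ⟩
    suc n * (n C suc k) + suc n * (n C k)
  ≡⟨ sym (*-distribˡ-+ (suc n) (n C suc k) (n C k)) ⟩
    suc n * (n C suc k + n C k)
  ≡⟨ cong (suc n *_) (trans (+-comm (n C suc k) (n C k)) (nCk+nC[k+1]≡[n+1]C[k+1] n k)) ⟩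
    suc n * (suc n C suc k)
  ∎
  where open ≡-Reasoning

nC[1+k]*[1+k]≡nCk*[n∸k] : ∀ n k → (n C suc k) * suc k ≡ (n C k) * (n ∸ k)
nC[1+k]*[1+k]≡nCk*[n∸k] n k = begin
    (n C suc k) * suc k
  ≡⟨ sym (m+n∸n≡m ((n C suc k) * suc k) ((n C k) * k)) ⟩
    ((n C suc k) * suc k + (n C k) * k) ∸ (n C k) * k
  ≡⟨ cong (_∸ (n C k) * k) (trans (nC[1+k]*[1+k]+nCk*k≡n*nCk n k) (*-comm n (n C k))) ⟩
    (n C k) * n ∸ (n C k) * k
  ≡⟨ sym (*-distribˡ-∸ (n C k) n k) ⟩
    (n C k) * (n ∸ k)
  ∎
  where open ≡-Reasoning

-- Truncated subtraction is harmless here: both factors of (n ∸ j) * suc k are monotone in the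
-- right direction, so no case split on j ≤ n is needed.
nC[1+j]*nCk≤nCj*nC[1+k] : ∀ n {j k} → k ≤ j → (n C suc j) * (n C k) ≤ (n C j) * (n C suc k)
nC[1+j]*nCk≤nCj*nC[1+k] n {j} {k} k≤j = *-cancelʳ-≤ _ _ (suc j * suc k) (begin
    (n C suc j) * (n C k) * (suc j * suc k)
  ≡⟨ interchange (n C suc j) (n C k) (suc j) (suc k) ⟩
    ((n C suc j) * suc j) * ((n C k) * suc k)
  ≡⟨ cong (_* ((n C k) * suc k)) (nC[1+k]*[1+k]≡nCk*[n∸k] n j) ⟩
    ((n C j) * (n ∸ j)) * ((n C k) * suc k)
  ≡⟨ interchange (n C j) (n ∸ j) (n C k) (suc k) ⟩
    ((n C j) * (n C k)) * ((n ∸ j) * suc k)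
  ≤⟨ *-monoʳ-≤ ((n C j) * (n C k)) ratio-decreasing ⟩
    ((n C j) * (n C k)) * (suc j * (n ∸ k))
  ≡⟨ interchange (n C j) (n C k) (suc j) (n ∸ k) ⟩
    ((n C j) * suc j) * ((n C k) * (n ∸ k))
  ≡⟨ cong (((n C j) * suc j) *_) (sym (nC[1+k]*[1+k]≡nCk*[n∸k] n k)) ⟩
    ((n C j) * suc j) * ((n C suc k) * suc k)
  ≡⟨ interchange (n C j) (suc j) (n C suc k) (suc k) ⟩
    (n C j) * (n C suc k) * (suc j * suc k)
  ∎)
  where
  open ≤-Reasoning
  ratio-decreasing : (n ∸ j) * suc k ≤ suc j * (n ∸ k)
  ratio-decreasing =
    ≤-trans (*-mono-≤ (∸-monoʳ-≤ n k≤j) (s≤s k≤j)) (≤-reflexive (*-comm (n ∸ k) (suc j)))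

module _ (n l k : ℕ) (k<l : k < l) where

  private
    l∸k≡1+l∸[1+k] : l ∸ k ≡ suc (l ∸ suc k)
    l∸k≡1+l∸[1+k] = +-∸-assoc 1 k<l

  prodBinom-increasing : suc (k + k) ≤ l → prodBinom n l k ≤ prodBinom n l (suc k)
  prodBinom-increasing 2k+1≤l rewrite l∸k≡1+l∸[1+k] =
    nC[1+j]*nCk≤nCj*nC[1+k] n (m+n≤o⇒m≤o∸n k (≤-trans (≤-reflexive (+-suc k k)) 2k+1≤l))

  prodBinom-decreasing : l ≤ suc (k + k) → prodBinom n l (suc k) ≤ prodBinom n l k
  prodBinom-decreasing l≤2k+1 rewrite l∸k≡1+l∸[1+k] = begin
      (n C j) * (n C suc k)     ≡⟨ *-comm (n C j) (n C suc k) ⟩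
      (n C suc k) * (n C j)     ≤⟨ nC[1+j]*nCk≤nCj*nC[1+k] n (m≤n+o⇒m∸n≤o l (suc k) l≤2k+1) ⟩
      (n C k) * (n C suc j)     ≡⟨ *-comm (n C k) (n C suc j) ⟩
      (n C suc j) * (n C k)     ∎
    where
    open ≤-Reasoning
    j = l ∸ suc k

module _ {a ℓ} {A : Set a} (_∼_ : Rel A ℓ) (∼-refl : Reflexive _∼_) (∼-trans : Transitive _∼_)
         (f : ℕ → A) {lo hi : ℕ} (step : ∀ k → lo ≤ k → suc k ≤ hi → f k ∼ f (suc k)) where

  stepwise⇒monotoneOn : ∀ {i j} → lo ≤ i → i ≤ j → j ≤ hi → f i ∼ f j
  stepwise⇒monotoneOn {i} lo≤i i≤j = go (≤⇒≤′ i≤j)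
    where
    go : ∀ {j} → i ≤′ j → j ≤ hi → f i ∼ f j
    go ≤′-refl            _      = ∼-refl
    go (≤′-step {j} i≤′j) 1+j≤hi =
      ∼-trans (go i≤′j (<⇒≤ 1+j≤hi)) (step j (≤-trans lo≤i (≤′⇒≤ i≤′j)) 1+j≤hi)

unimodal-from-steps : (a : ℕ → ℕ) {m len : ℕ} → m ≤ len →
                      (∀ k → suc k ≤ m → a k ≤ a (suc k)) →
                      (∀ k → m ≤ k → suc k ≤ len → a (suc k) ≤ a k) →
                      UnimodalUpTo len a
unimodal-from-steps a {m} m≤len up down =
    m , m≤len
  , (λ i j i≤j j≤m → stepwise⇒monotoneOn _≤_ ≤-refl ≤-trans a (λ k _ → up k) z≤n i≤j j≤m)
  , (λ i j m≤i i≤j j≤len → stepwise⇒monotoneOn _≥_ ≤-refl (flip ≤-trans) a down m≤i i≤j j≤len)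

k<⌊n/2⌋⇒1+k+k≤n : ∀ {n k} → k < ⌊ n /2⌋ → suc (k + k) ≤ n
k<⌊n/2⌋⇒1+k+k≤n {n} {k} k<h = begin
    suc k + k               ≤⟨ +-mono-≤ k<h (<⇒≤ k<h) ⟩
    ⌊ n /2⌋ + ⌊ n /2⌋       ≤⟨ +-monoʳ-≤ ⌊ n /2⌋ (⌊n/2⌋≤⌈n/2⌉ n) ⟩
    ⌊ n /2⌋ + ⌈ n /2⌉       ≡⟨ ⌊n/2⌋+⌈n/2⌉≡n n ⟩
    n                       ∎
  where open ≤-Reasoning

⌊n/2⌋≤k⇒n≤1+k+k : ∀ {n k} → ⌊ n /2⌋ ≤ k → n ≤ suc (k + k)
⌊n/2⌋≤k⇒n≤1+k+k {n} {k} h≤k = begin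
    n                         ≡⟨ sym (⌊n/2⌋+⌈n/2⌉≡n n) ⟩
    ⌊ n /2⌋ + ⌈ n /2⌉         ≤⟨ +-mono-≤ h≤k (⌊n/2⌋-mono (n≤1+n (suc n))) ⟩
    k + suc ⌊ n /2⌋           ≤⟨ +-monoʳ-≤ k (s≤s h≤k) ⟩
    k + suc k                 ≡⟨ +-suc k k ⟩
    suc (k + k)               ∎
  where open ≤-Reasoning

theorem3p2 : (n l : ℕ) → UnimodalUpTo l (prodBinom n l)
theorem3p2 n l = unimodal-from-steps (prodBinom n l) (⌊n/2⌋≤n l) up down
  where
  up : ∀ k → suc k ≤ ⌊ l /2⌋ → prodBinom n l k ≤ prodBinom n l (suc k)
  up k k<h = prodBinom-increasing n l k (≤-trans (s≤s (m≤m+n k k)) 2k+1≤l) 2k+1≤l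
    where 2k+1≤l = k<⌊n/2⌋⇒1+k+k≤n k<h
  down : ∀ k → ⌊ l /2⌋ ≤ k → suc k ≤ l → prodBinom n l (suc k) ≤ prodBinom n l k
  down k h≤k k<l = prodBinom-decreasing n l k k<l (⌊n/2⌋≤k⇒n≤1+k+k h≤k)
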